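{- Let $\Sigma$ be a finite signature. For $v\in\mathcal I$ let $\gamma_v=\bigwedge_{p\in\Sigma,\ v(p)=2}p$. Then for any formula $\alpha$ over $\Sigma$ and any $v\in[\![\alpha]\!]_c$, we have $v\in[\![\alpha\wedge\gamma_v]\!]_e$.
   Context: $\Sigma$ is a finite set of atoms. Formulas are given by $\alpha ::= \bot \mid p \mid \alpha_1\wedge\alpha_2 \mid \alpha_1\vee\alpha_2 \mid \alpha_1\rightarrow\alpha_2$ with $p\in\Sigma$; $\top$ abbreviates $\bot\to\bot$, and an empty conjunction is read as $\top$. A partial interpretation is a map $v:\Sigma\to\{0,1,2\}$; $\mathcal I$ is the set of all of them and $\mathcal I_c$ the set of classical ones (no atom mapped to $1$). The $G_3$ valuation extends $v$ to formulas: $v(\bot)=0$, $v(\alpha\wedge\beta)=\min(v(\alpha),v(\beta))$, $v(\alpha\vee\beta)=\max(v(\alpha),v(\beta))$, $v(\alpha\to\beta)=2$ if $v(\alpha)\le v(\beta)$ and $=v(\beta)$ otherwise; $v$ is a model of $\alpha$ iff $v(\alpha)=2$. The order on $\mathcal I$: $u\le v$ iff for every atom $p$, $u(p)\le v(p)$ and ($u(p)=0$ implies $v(p)=0$). A classical interpretation is an equilibrium model of $\alpha$ iff it is a $\le$-minimal model of $\alpha$; $[\![\alpha]\!]_e$ is the set of equilibrium models of $\alpha$. For $S\subseteq\mathcal I$: $\overline S=\mathcal I\setminus S$; $S_c=S\cap\mathcal I_c$; $S\downarrow=\{u\in\mathcal I:\exists v\in S,\ v\ge u\}$. The denotation: $[\![\bot]\!]=\emptyset$;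 $[\![p]\!]=\{v\in\mathcal I: v(p)=2\}$; $[\![\alpha\wedge\beta]\!]=[\![\alpha]\!]\cap[\![\beta]\!]$; $[\![\alpha\vee\beta]\!]=[\![\alpha]\!]\cup[\![\beta]\!]$; $[\![\alpha\to\beta]\!]=\big(\overline{[\![\alpha]\!]}\cup[\![\beta]\!]\big)\cap\big((\overline{[\![\alpha]\!]}\cup[\![\beta]\!])_c\big)\downarrow$; and $[\![\alpha]\!]_c=[\![\alpha]\!]\cap\mathcal I_c$. -}

module Defs where

open import Data.Nat using (ℕ; zero; suc)
open import Data.Fin using (Fin)
open import Data.List using (List; []; _∷_; filter)
open import Data.List using (allFin) public
open import Data.Product using (_×_; ∃; _,_)
open import Data.Sum using (_⊎_)
open import Data.Empty using (⊥)
open import Relation.Nullary using (¬_; Dec; yes; no)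
open import Relation.Binary.PropositionalEquality using (_≡_; refl)

-- Truth values of G3 : 0, 1, 2
data V3 : Set where
  v0 v1 v2 : V3

_≟₃_ : (a b : V3) → Dec (a ≡ b)
v0 ≟₃ v0 = yes refl
v0 ≟₃ v1 = no λ ()
v0 ≟₃ v2 = no λ ()
v1 ≟₃ v0 = no λ ()
v1 ≟₃ v1 = yes refl
v1 ≟₃ v2 = no λ ()
v2 ≟₃ v0 = no λ ()
v2 ≟₃ v1 = no λ ()
v2 ≟₃ v2 = yes refl

data _≤₃_ : V3 → V3 → Set where
  0≤ : ∀ {b} → v0 ≤₃ b
  1≤1 : v1 ≤₃ v1
  1≤2 : v1 ≤₃ v2
  2≤2 : v2 ≤₃ v2

min₃ : V3 → V3 → V3
min₃ v0 _ = v0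
min₃ v1 v0 = v0
min₃ v1 _ = v1
min₃ v2 b = b

max₃ : V3 → V3 → V3
max₃ v0 b = b
max₃ v1 v2 = v2
max₃ v1 _ = v1
max₃ v2 _ = v2

-- G3 implication: 2 if a ≤ b, else b
imp₃ : V3 → V3 → V3
imp₃ v0 _ = v2
imp₃ v1 v0 = v0
imp₃ v1 _ = v2
imp₃ v2 b = b

data Form (n : ℕ) : Set where
  ⊥′ : Form n
  atom : Fin n → Form n
  _∧′_ _∨′_ _⇒′_ : Form n → Form n → Form n

⊤′ : ∀ {n} → Form n
⊤′ = ⊥′ ⇒′ ⊥′

⋀ : ∀ {n} → List (Form n) → Form n
⋀ [] = ⊤′
⋀ (φ ∷ []) = φ
⋀ (φ ∷ φs@(_ ∷ _)) = φ ∧′ ⋀ φs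

Interp : ℕ → Set
Interp n = Fin n → V3

Classical : ∀ {n} → Interp n → Set
Classical v = ∀ p → ¬ (v p ≡ v1)

eval : ∀ {n} → Interp n → Form n → V3
eval v ⊥′ = v0
eval v (atom p) = v p
eval v (α ∧′ β) = min₃ (eval v α) (eval v β)
eval v (α ∨′ β) = max₃ (eval v α) (eval v β)
eval v (α ⇒′ β) = imp₃ (eval v α) (eval v β)

Model : ∀ {n} → Interp n → Form n → Set
Model v α = eval v α ≡ v2

_⊑_ : ∀ {n} → Interp n → Interp n → Set
u ⊑ v = ∀ p → (u p ≤₃ v p) × (u p ≡ v0 → v p ≡ v0)

Equilibrium : ∀ {n} → Interp n → Form n → Set
Equilibrium v α =
  Classical v × Model v α × (∀ u → u ⊑ v → Model u α → ∀ p → u p ≡ v p)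

ISet : ℕ → Set₁
ISet n = Interp n → Set

compl : ∀ {n} → ISet n → ISet n
compl S v = ¬ S v

_∪_ : ∀ {n} → ISet n → ISet n → ISet n
(S ∪ T) v = S v ⊎ T v

_∩_ : ∀ {n} → ISet n → ISet n → ISet n
(S ∩ T) v = S v × T v

_ᶜˡ : ∀ {n} → ISet n → ISet n
(S ᶜˡ) v = S v × Classical v

_↓ : ∀ {n} → ISet n → ISet n
(S ↓) u = ∃ λ v → S v × (u ⊑ v)

⟦_⟧ : ∀ {n} → Form n → ISet n
⟦ ⊥′ ⟧ v = ⊥
⟦ atom p ⟧ v = v p ≡ v2
⟦ α ∧′ β ⟧ = ⟦ α ⟧ ∩ ⟦ β ⟧
⟦ α ∨′ β ⟧ = ⟦ α ⟧ ∪ ⟦ β ⟧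
⟦ α ⇒′ β ⟧ = (compl ⟦ α ⟧ ∪ ⟦ β ⟧) ∩ (((compl ⟦ α ⟧ ∪ ⟦ β ⟧) ᶜˡ) ↓)

⟦_⟧c : ∀ {n} → Form n → ISet n
⟦ α ⟧c = ⟦ α ⟧ ᶜˡ

γ : ∀ {n} → Interp n → Form n
γ {n} v = ⋀ (Data.List.map atom (filter (λ p → v p ≟₃ v2) (allFin n)))

-- On a classical interpretation every formula takes one of the crisp values 0, 2, and
-- the denotation agrees with the G3 models: the ↓-part of an implication is witnessed by
-- the interpretation itself. So v ⊨ α ∧ γ_v. For minimality, u ⊑ v forces u to be 0
-- wherever v is, and u ⊨ γ_v forces u to be 2 wherever v is; as v is classical, u = v.
module Submission where

open import Defs
open import Data.Nat using (ℕ)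
open import Data.List using ([]; _∷_)
open import Data.List.Relation.Unary.All as All using (All; []; _∷_)
open import Data.List.Relation.Unary.All.Properties using (map⁺; map⁻; all-filter)
open import Data.List.Membership.Propositional.Properties using (∈-filter⁺; ∈-allFin)
open import Data.Product using (_×_; _,_; proj₁; proj₂)
open import Data.Product.Function.NonDependent.Propositional using (_×-⇔_)
open import Data.Sum using (_⊎_; inj₁; inj₂)
open import Data.Sum.Function.Propositional using (_⊎-⇔_)
open import Data.Empty using (⊥-elim)
open import Function.Bundles using (_⇔_; mk⇔; Equivalence)
open import Function.Construct.Composition using (_⇔-∘_)
open import Function.Construct.Symmetry using (⇔-sym)
import Function.Related.Propositional
open import Function.Related.TypeIsomorphisms using (¬-cong-⇔)
open import Relation.Nullary using (¬_)
open import Relation.Binary.PropositionalEquality using (_≡_; _≢_; refl)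

open Equivalence using (to; from)

Crisp : V3 → Set
Crisp a = a ≢ v1

≤₃-refl : ∀ a → a ≤₃ a
≤₃-refl v0 = 0≤
≤₃-refl v1 = 1≤1
≤₃-refl v2 = 2≤2

min₃-crisp : ∀ {a b} → Crisp a → Crisp b → Crisp (min₃ a b)
min₃-crisp {v0} _   _   ()
min₃-crisp {v1} a≢1 _   = ⊥-elim (a≢1 refl)
min₃-crisp {v2} _   b≢1 = b≢1

max₃-crisp : ∀ {a b} → Crisp a → Crisp b → Crisp (max₃ a b)
max₃-crisp {v0} _   b≢1 = b≢1
max₃-crisp {v1} a≢1 _   = ⊥-elim (a≢1 refl)
max₃-crisp {v2} _   _   ()

imp₃-crisp : ∀ {a b} → Crisp a → Crisp b → Crisp (imp₃ a b)
imp₃-crisp {v0} _   _   ()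
imp₃-crisp {v1} a≢1 _   = ⊥-elim (a≢1 refl)
imp₃-crisp {v2} _   b≢1 = b≢1

min₃≡v2⇔ : ∀ {a b} → min₃ a b ≡ v2 ⇔ (a ≡ v2 × b ≡ v2)
min₃≡v2⇔ = mk⇔ (to′ _ _) (λ { (refl , refl) → refl })
  where
  to′ : ∀ a b → min₃ a b ≡ v2 → a ≡ v2 × b ≡ v2
  to′ v0 _  ()
  to′ v1 v0 ()
  to′ v1 v1 ()
  to′ v1 v2 ()
  to′ v2 _  b≡2 = refl , b≡2

max₃≡v2⇔ : ∀ {a b} → max₃ a b ≡ v2 ⇔ (a ≡ v2 ⊎ b ≡ v2)
max₃≡v2⇔ = mk⇔ (to′ _ _) (from′ _ _)
  where
  to′ : ∀ a b → max₃ a b ≡ v2 → a ≡ v2 ⊎ b ≡ v2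
  to′ v0 _  b≡2 = inj₂ b≡2
  to′ v1 v2 _   = inj₂ refl
  to′ v2 _  _   = inj₁ refl
  to′ v1 v0 ()
  to′ v1 v1 ()
  from′ : ∀ a b → a ≡ v2 ⊎ b ≡ v2 → max₃ a b ≡ v2
  from′ v2 _  _ = refl
  from′ v0 v2 _ = refl
  from′ v1 v2 _ = refl
  from′ v0 v0 (inj₂ ())
  from′ v0 v1 (inj₂ ())
  from′ v1 v0 (inj₂ ())
  from′ v1 v1 (inj₂ ())

imp₃≡v2⇔ : ∀ {a b} → Crisp a → imp₃ a b ≡ v2 ⇔ (a ≢ v2 ⊎ b ≡ v2)
imp₃≡v2⇔ {v0} _   = mk⇔ (λ _ → inj₁ λ ()) (λ _ → refl)
imp₃≡v2⇔ {v1} a≢1 = ⊥-elim (a≢1 refl)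
imp₃≡v2⇔ {v2} _   = mk⇔ inj₂ λ { (inj₁ 2≢2) → ⊥-elim (2≢2 refl) ; (inj₂ b≡2) → b≡2 }

≤₃-crisp-≡ : ∀ {a b} → Crisp b → a ≤₃ b → (b ≡ v2 → a ≡ v2) → a ≡ b
≤₃-crisp-≡ {b = v0} _   0≤ _      = refl
≤₃-crisp-≡ {b = v1} b≢1 _  _      = ⊥-elim (b≢1 refl)
≤₃-crisp-≡ {b = v2} _   _  a-true = a-true refl

module _ {n : ℕ} where

  ⊑-refl : (v : Interp n) → v ⊑ v
  ⊑-refl v p = ≤₃-refl (v p) , λ e → e

  ⊑-classical-≗ : ∀ {u v : Interp n} → Classical v → u ⊑ v →
                  (∀ p → v p ≡ v2 → u p ≡ v2) → ∀ p → u p ≡ v p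
  ⊑-classical-≗ v-cl u⊑v agree p = ≤₃-crisp-≡ (v-cl p) (proj₁ (u⊑v p)) (agree p)

  ∩-ᶜˡ↓⇔ : ∀ {S : ISet n} {v} → Classical v → (S ∩ ((S ᶜˡ) ↓)) v ⇔ S v
  ∩-ᶜˡ↓⇔ {v = v} v-cl = mk⇔ proj₁ λ s → s , v , (s , v-cl) , ⊑-refl v

  module _ {v : Interp n} (v-cl : Classical v) where

    eval-crisp : ∀ α → Crisp (eval v α)
    eval-crisp ⊥′       = λ ()
    eval-crisp (atom p) = v-cl p
    eval-crisp (α ∧′ β) = min₃-crisp (eval-crisp α) (eval-crisp β)
    eval-crisp (α ∨′ β) = max₃-crisp (eval-crisp α) (eval-crisp β)
    eval-crisp (α ⇒′ β) = imp₃-crisp (eval-crisp α) (eval-crisp β)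

    ⟦⟧⇔Model : ∀ α → ⟦ α ⟧ v ⇔ Model v α
    ⟦⟧⇔Model ⊥′       = mk⇔ (λ ()) (λ ())
    ⟦⟧⇔Model (atom p) = mk⇔ (λ e → e) (λ e → e)
    ⟦⟧⇔Model (α ∧′ β) = ⇔-sym min₃≡v2⇔ ⇔-∘ (⟦⟧⇔Model α ×-⇔ ⟦⟧⇔Model β)
    ⟦⟧⇔Model (α ∨′ β) = ⇔-sym max₃≡v2⇔ ⇔-∘ (⟦⟧⇔Model α ⊎-⇔ ⟦⟧⇔Model β)
    ⟦⟧⇔Model (α ⇒′ β) = begin
      ⟦ α ⇒′ β ⟧ v                ∼⟨ ∩-ᶜˡ↓⇔ v-cl ⟩
      (¬ ⟦ α ⟧ v ⊎ ⟦ β ⟧ v)       ∼⟨ ¬-cong-⇔ (⟦⟧⇔Model α) ⊎-⇔ ⟦⟧⇔Model β ⟩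
      (¬ Model v α ⊎ Model v β)   ∼⟨ ⇔-sym (imp₃≡v2⇔ (eval-crisp α)) ⟩
      Model v (α ⇒′ β)            ∎
      where open Function.Related.Propositional.EquationalReasoning

  ⋀-Model⇔ : ∀ {u : Interp n} φs → Model u (⋀ φs) ⇔ All (Model u) φs
  ⋀-Model⇔ []               = mk⇔ (λ _ → []) (λ _ → refl)
  ⋀-Model⇔ (φ ∷ [])         = mk⇔ (_∷ []) All.head
  ⋀-Model⇔ (φ ∷ φs@(_ ∷ _)) = mk⇔
    (λ u⊨φ∧φs → let u⊨φ , u⊨φs = to min₃≡v2⇔ u⊨φ∧φs in u⊨φ ∷ to (⋀-Model⇔ φs) u⊨φs)
    (λ u⊨all → from min₃≡v2⇔ (All.head u⊨all , from (⋀-Model⇔ φs) (All.tail u⊨all)))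

  γ-Model⇔ : ∀ (u v : Interp n) → Model u (γ v) ⇔ (∀ p → v p ≡ v2 → u p ≡ v2)
  γ-Model⇔ u v = mk⇔
    (λ u⊨γ p v≡2 → All.lookup (map⁻ (to (⋀-Model⇔ _) u⊨γ)) (∈-filter⁺ true? (∈-allFin p) v≡2))
    (λ agree → from (⋀-Model⇔ _) (map⁺ (All.map (λ {p} → agree p) (all-filter true? (allFin n)))))
    where
    true? = λ q → v q ≟₃ v2

lemma4 : (n : ℕ) (α : Form n) (v : Interp n) →
    ⟦ α ⟧c v → Equilibrium v (α ∧′ γ v)
lemma4 n α v (v∈α , v-cl) = v-cl , v⊨α∧γ , minimal
  where
  v⊨α∧γ : Model v (α ∧′ γ v)
  v⊨α∧γ = from min₃≡v2⇔ (to (⟦⟧⇔Model v-cl α) v∈α , from (γ-Model⇔ v v) λ _ v≡2 → v≡2)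

  minimal : ∀ u → u ⊑ v → Model u (α ∧′ γ v) → ∀ p → u p ≡ v p
  minimal u u⊑v u⊨α∧γ = ⊑-classical-≗ v-cl u⊑v (to (γ-Model⇔ u v) (proj₂ (to min₃≡v2⇔ u⊨α∧γ)))
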